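{- Let $c_1\prec c_2\prec\cdots\prec c_\sigma$ be the alphabet. Let $x$ be a word of length $n\ge1$ that is lexicographically smallest among all its cyclic rotations, and let $(e_1,\dots,e_\sigma)$ be its Parikh vector. Let $y=c_1^{e_1}c_2^{e_2}\cdots c_\sigma^{e_\sigma}$, and let $i$ be the length of the longest common prefix of $x$ and $y$. If $x[i]\neq x[n]$, then there exists an integer $k$ such that $\mathit{rot}^k\bigl(\mathsf{BBWT}^{ -1}(\mathit{rot}(x))\bigr)\prec x$.
   Context: $\prec$ denotes the lexicographic order on strings induced by the character order. The Parikh vector of $x$ lists, for each $c_j$, the number $e_j$ of occurrences of $c_j$ in $x$. $\mathit{rot}(x)=x[n]\,x[1..n-1]$, $\mathit{rot}^0$ is the identity and $\mathit{rot}^k=\mathit{rot}\circ\mathit{rot}^{k-1}$. A Lyndon word is a nonempty string strictly smaller than all its proper nonempty suffixes, and every string has a unique Lyndon factorization $w=u_1\cdots u_m$ into Lyndon words with $u_1\succeq\cdots\succeq u_m$. For primitive $x,y$, $x\prec_\omega y$ iff $x^\infty\prec y^\infty$. $\mathsf{BBWT}(w)$ is obtained as follows: take the multiset of all cyclic rotations of all Lyndon factors $u_j$ (each contributing its $|u_j|$ rotations), sort it in $\omega$-order, and concatenate the last characters. $\mathsf{BBWT}$ is a bijection on the set of strings of each fixed length, and $\mathsf{BBWT}^{ -1}$ denotes its inverse. -}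

module Defs where

open import Data.Nat using (ℕ; zero; suc; _∸_; _≤_; _<_)
open import Data.Fin as F using (Fin; toℕ)
open import Data.Fin.Properties using (_≟_)
open import Data.List using (List; []; _∷_; _++_; length; reverse; replicate; concat;
  concatMap; map; drop; filter; allFin; upTo; head)
open import Data.List.Relation.Unary.All using (All)
open import Data.List.Relation.Unary.Linked using (Linked)
open import Data.List.Relation.Binary.Permutation.Propositional using (_↭_)
open import Data.List.Relation.Binary.Pointwise using (Pointwise)
open import Data.Maybe using (Maybe; just; nothing)
open import Data.Product using (Σ; ∃; ∃-syntax; _×_; _,_)
open import Relation.Binary.PropositionalEquality using (_≡_; _≢_)
open import Relation.Nullary using (¬_; yes; no)
open import Function using (_∘_)

-- Alphabet c_1 ≺ ... ≺ c_σ is Fin σ, ordered by toℕ (Fin's _<_).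
Word : ℕ → Set
Word σ = List (Fin σ)

module _ {σ : ℕ} where

  data _≺_ : Word σ → Word σ → Set where
    []≺  : ∀ {b bs} → [] ≺ (b ∷ bs)
    here : ∀ {a b as bs} → a F.< b → (a ∷ as) ≺ (b ∷ bs)
    there : ∀ {a as bs} → as ≺ bs → (a ∷ as) ≺ (a ∷ bs)

  rot : Word σ → Word σ
  rot xs with reverse xs
  ... | []    = []
  ... | c ∷ r = c ∷ reverse r

  rot^ : ℕ → Word σ → Word σ
  rot^ zero    x = x
  rot^ (suc k) x = rot (rot^ k x)

  MinRotation : Word σ → Set
  MinRotation x = ∀ k → ¬ (rot^ k x ≺ x)

  Lyndon : Word σ → Set
  Lyndon u = (0 < length u) × (∀ k → 1 ≤ k → k < length u → u ≺ drop k u)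

  LyndonFactorization : List (Word σ) → Word σ → Set
  LyndonFactorization us w =
    All Lyndon us × Linked (λ a b → ¬ (a ≺ b)) us × concat us ≡ w

  -- j-th character (0-based) of the infinite word x^∞ (nothing iff x = [])
  ω-at : Word σ → ℕ → Maybe (Fin σ)
  ω-at x j = head (drop j (concat (replicate (suc j) x)))

  -- x ≺_ω y  iff  x^∞ ≺ y^∞
  _≺ω_ : Word σ → Word σ → Set
  x ≺ω y = ∃[ m ] ((∀ j → j < m → ω-at x j ≡ ω-at y j) ×
             Σ (Fin σ) λ a → Σ (Fin σ) λ b →
               ω-at x m ≡ just a × ω-at y m ≡ just b × a F.< b)

  rotations : Word σ → List (Word σ)
  rotations u = map (λ k → rot^ k u) (upTo (length u))

  -- z = BBWT(w): for the Lyndon factorization us of w, ss is the multiset of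
  -- all rotations of all factors sorted in ω-order, and z lists their last characters.
  IsBBWT : Word σ → Word σ → Set
  IsBBWT w z = Σ (List (Word σ)) λ us → Σ (List (Word σ)) λ ss →
    LyndonFactorization us w ×
    ss ↭ concatMap rotations us ×
    Linked (λ a b → ¬ (b ≺ω a)) ss ×
    Pointwise (λ s c → Data.List.last s ≡ just c) ss z

  count : Fin σ → Word σ → ℕ
  count c x = length (filter (_≟ c) x)

  sortedWord : Word σ → Word σ
  sortedWord x = concatMap (λ c → replicate (count c x) c) (allFin σ)

  lcp : Word σ → Word σ → ℕ
  lcp [] _ = 0
  lcp (_ ∷ _) [] = 0
  lcp (a ∷ as) (b ∷ bs) with a ≟ b
  ... | yes _ = suc (lcp as bs)
  ... | no _  = 0

  -- 1-indexed character access: at x i = just x[i] for 1 ≤ i ≤ |x|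
  at : Word σ → ℕ → Maybe (Fin σ)
  at x zero    = nothing
  at x (suc i) = head (drop i x)

-- Let z = rot(x) = x[n] x[1..n−1]. The rows of the BBWT matrix of w = BBWT⁻¹(z) are the rotations
-- of the Lyndon factors of w in ω-order, and z is their last column. Their first column is sorted
-- and has the letters of z, so it is y. Since x[i] ≠ x[n] and y is sorted, the letter x[n] does not
-- occur in y[1..i]; hence for r ≤ i the LF-mapping matches the letter y[r] starting row r with the
-- letter z[r+1] = x[r] ending row r+1, i.e. row r is row r+1 rotated by one. Following these rows,
-- the first row agrees with y on its first i+1 letters. The first row is itself a Lyndon factor u
-- of w (a proper rotation of a Lyndon word is ω-larger than it), and it is longer than i because
-- it ends with z[1] = x[n]. As y[1..i] = x[1..i] and y[i+1] < x[i+1], the rotation of w that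
-- starts with u is smaller than x.

module Submission where

open import Defs
open import Data.Nat using (ℕ; zero; suc; _+_; _*_; _∸_; _≤_; _<_; z≤n; s≤s; s≤s⁻¹; _<?_; >-nonZero; NonZero)
open import Data.Nat.Divisibility using (_∣_; divides; m∣m*n; n∣m*n)
open import Data.Nat.DivMod using (_/_; _%_; m≡m%n+[m/n]*n; m%n<n)
open import Data.Nat.Properties
open import Data.Fin as Fin using (Fin)
import Data.Fin.Properties as FinP
open import Data.List
open import Data.List.Reverse using (reverseView; []; _∶_∶ʳ_)
open import Data.List.Properties
open import Data.List.Relation.Unary.All as All using (All; []; _∷_)
open import Data.List.Relation.Unary.Any as Any using (here; there)
import Data.List.Relation.Unary.Any.Properties as AnyP
import Data.List.Relation.Unary.All.Properties as AllP
open import Data.List.Relation.Unary.Linked as Linked using (Linked; []; [-]; _∷_)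
open import Data.List.Relation.Unary.Linked.Properties using (Linked⇒AllPairs)
open import Data.List.Relation.Unary.AllPairs using (AllPairs; []; _∷_)
import Data.List.Relation.Unary.AllPairs.Properties as AllPairsP
open import Data.List.Relation.Binary.Permutation.Propositional using (_↭_; ↭-refl; ↭-sym; module PermutationReasoning)
open import Data.List.Relation.Binary.Permutation.Propositional.Properties
  using (filter-↭; ↭-length; ∷↭∷ʳ; ∈-resp-↭; ++⁺; map⁺)
open import Data.List.Membership.Propositional as Membership using (_∈_)
open import Data.List.Membership.Propositional.Properties
  using (∈-concatMap⁻; ∈-concatMap⁺; ∈-map⁻; ∈-map⁺; ∈-upTo⁻; ∈-upTo⁺; ∈-∃++)
open import Data.List.Relation.Binary.Pointwise as Pointwise using (Pointwise; []; _∷_; Pointwise-length)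
open import Data.Maybe using (Maybe; just; nothing)
open import Data.Maybe.Properties as MaybeP using (just-injective)
open import Data.Product using (Σ; ∃-syntax; ∃₂; _×_; _,_; proj₁; proj₂)
open import Data.Sum using (_⊎_; inj₁; inj₂)
open import Relation.Nullary using (¬_; Dec; yes; no; ¬?; contradiction)
open import Relation.Binary.PropositionalEquality
open import Relation.Binary.Definitions using (tri<; tri≈; tri>)
open import Function using (id; _∘_; _∘′_)

module _ {A : Set} where

  _!?_ : List A → ℕ → Maybe A
  xs !? i = head (drop i xs)

  !?-++ˡ : (xs ys : List A) {i : ℕ} → i < length xs → (xs ++ ys) !? i ≡ xs !? i
  !?-++ˡ (x ∷ xs) ys {zero}  _         = refl
  !?-++ˡ (x ∷ xs) ys {suc i} (s≤s i<n) = !?-++ˡ xs ys i<n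

  !?-++ʳ : (xs ys : List A) (i : ℕ) → (xs ++ ys) !? (length xs + i) ≡ ys !? i
  !?-++ʳ []       ys i = refl
  !?-++ʳ (x ∷ xs) ys i = !?-++ʳ xs ys i

  !?-middle : (xs ys : List A) (y : A) → (xs ++ y ∷ ys) !? length xs ≡ just y
  !?-middle []       ys y = refl
  !?-middle (x ∷ xs) ys y = !?-middle xs ys y

  !?-drop : (xs : List A) (i j : ℕ) → drop i xs !? j ≡ xs !? (i + j)
  !?-drop xs i j = cong head (drop-drop i j xs)

  !?-defined : (xs : List A) {i : ℕ} → i < length xs → ∃[ x ] xs !? i ≡ just x
  !?-defined (x ∷ xs) {zero}  _         = x , refl
  !?-defined (x ∷ xs) {suc i} (s≤s i<n) = !?-defined xs i<n

  !?-last : (xs : List A) → 0 < length xs → xs !? (length xs ∸ 1) ≡ last xs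
  !?-last (x ∷ [])     _ = refl
  !?-last (x ∷ y ∷ xs) _ = !?-last (y ∷ xs) (s≤s z≤n)

  last-∷ʳ : (xs : List A) (x : A) → last (xs ∷ʳ x) ≡ just x
  last-∷ʳ []           x = refl
  last-∷ʳ (y ∷ [])     x = refl
  last-∷ʳ (y ∷ z ∷ xs) x = last-∷ʳ (z ∷ xs) x

  ∈-!? : (xs : List A) (k : ℕ) {x : A} → xs !? k ≡ just x → x ∈ xs
  ∈-!? (x ∷ xs) zero    refl = here refl
  ∈-!? (_ ∷ xs) (suc k) eq   = there (∈-!? xs k eq)

  drop-!? : (xs : List A) (k : ℕ) {x : A} → xs !? k ≡ just x → drop k xs ≡ x ∷ drop (suc k) xs
  drop-!? (x ∷ xs) zero    refl = refl
  drop-!? (_ ∷ xs) (suc k) eq   = drop-!? xs k eq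

  take-!?-drop : (xs : List A) (k : ℕ) {x : A} → xs !? k ≡ just x → take k xs ++ x ∷ drop (suc k) xs ≡ xs
  take-!?-drop xs k eq = trans (cong (take k xs ++_) (sym (drop-!? xs k eq))) (take++drop≡id k xs)

  take-cong-!? : (xs ys : List A) (i : ℕ) → (∀ j → j < i → xs !? j ≡ ys !? j) → take i xs ≡ take i ys
  take-cong-!? xs       ys       zero    _ = refl
  take-cong-!? []       []       (suc i) _ = refl
  take-cong-!? []       (y ∷ ys) (suc i) eq with eq 0 (s≤s z≤n)
  ... | ()
  take-cong-!? (x ∷ xs) []       (suc i) eq with eq 0 (s≤s z≤n)
  ... | ()
  take-cong-!? (x ∷ xs) (y ∷ ys) (suc i) eq with eq 0 (s≤s z≤n)
  ... | refl = cong (x ∷_) (take-cong-!? xs ys i (λ j j<i → eq (suc j) (s≤s j<i)))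

  take-++ˡ : (xs ys : List A) {i : ℕ} → i ≤ length xs → take i (xs ++ ys) ≡ take i xs
  take-++ˡ xs       ys {zero}  _         = refl
  take-++ˡ (x ∷ xs) ys {suc i} (s≤s i≤n) = cong (x ∷_) (take-++ˡ xs ys i≤n)

  All-!? : {P : A → Set} {xs : List A} (i : ℕ) {x : A} → All P xs → xs !? i ≡ just x → P x
  All-!? zero    (px ∷ _)  refl = px
  All-!? (suc i) (_ ∷ pxs) eq   = All-!? i pxs eq

  filter-!? : {P : A → Set} (P? : ∀ x → Dec (P x)) (xs : List A) (k : ℕ) {x : A} → xs !? k ≡ just x → P x →
              filter P? xs ≡ filter P? (take k xs) ++ x ∷ filter P? (drop (suc k) xs)
  filter-!? P? xs k {x} eq px = begin
      filter P? xs                                            ≡⟨ cong (filter P?) (take-!?-drop xs k eq) ⟨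
      filter P? (take k xs ++ x ∷ drop (suc k) xs)            ≡⟨ filter-++ P? (take k xs) _ ⟩
      filter P? (take k xs) ++ filter P? (x ∷ drop (suc k) xs) ≡⟨ cong (filter P? (take k xs) ++_) (filter-accept P? px) ⟩
      filter P? (take k xs) ++ x ∷ filter P? (drop (suc k) xs) ∎
    where open ≡-Reasoning

  concatMap-↭ : {B : Set} {f g : A → List B} → (∀ x → f x ↭ g x) → (xs : List A) → concatMap f xs ↭ concatMap g xs
  concatMap-↭ f↭g []       = ↭-refl
  concatMap-↭ f↭g (x ∷ xs) = ++⁺ (f↭g x) (concatMap-↭ f↭g xs)

  pow : ℕ → List A → List A
  pow m xs = concat (replicate m xs)

  length-pow : (m : ℕ) (xs : List A) → length (pow m xs) ≡ m * length xs
  length-pow zero    xs = refl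
  length-pow (suc m) xs = trans (length-++ xs) (cong (length xs +_) (length-pow m xs))

  pow-+ : (m k : ℕ) (xs : List A) → pow (m + k) xs ≡ pow m xs ++ pow k xs
  pow-+ zero    k xs = refl
  pow-+ (suc m) k xs = trans (cong (xs ++_) (pow-+ m k xs)) (sym (++-assoc xs (pow m xs) (pow k xs)))

  pow-∷ : (m : ℕ) (x : A) (xs : List A) → pow (suc m) (x ∷ xs) ≡ x ∷ (pow m (xs ∷ʳ x) ++ xs)
  pow-∷ zero    x xs = cong (x ∷_) (++-identityʳ xs)
  pow-∷ (suc m) x xs = cong (x ∷_) (begin
      xs ++ pow (suc m) (x ∷ xs)              ≡⟨ cong (xs ++_) (pow-∷ m x xs) ⟩
      xs ++ x ∷ (pow m (xs ∷ʳ x) ++ xs)       ≡⟨ sym (++-assoc xs (x ∷ []) _) ⟩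
      (xs ∷ʳ x) ++ (pow m (xs ∷ʳ x) ++ xs)    ≡⟨ sym (++-assoc (xs ∷ʳ x) (pow m (xs ∷ʳ x)) xs) ⟩
      pow (suc m) (xs ∷ʳ x) ++ xs             ∎)
    where open ≡-Reasoning

  <-length-pow : (m : ℕ) (xs : List A) {j : ℕ} → 0 < length xs → j < m → j < length (pow m xs)
  <-length-pow m xs {j} 0<n j<m = begin-strict
      j                ≤⟨ m≤m*n j (length xs) ⟩
      j * length xs    <⟨ *-monoˡ-< (length xs) j<m ⟩
      m * length xs    ≡⟨ length-pow m xs ⟨
      length (pow m xs) ∎
    where
    open ≤-Reasoning
    instance _ = >-nonZero 0<n

  nonempty-pow : (m : ℕ) (xs : List A) {j : ℕ} → j < length (pow m xs) → 0 < length xs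
  nonempty-pow m []      {j} j<n = contradiction (trans (length-pow m []) (*-zeroʳ m)) (>⇒≢ (≤-<-trans z≤n j<n))
  nonempty-pow m (_ ∷ _) _       = s≤s z≤n

module _ {A B : Set} {R : A → B → Set} where

  Pointwise-!? : {xs : List A} {ys : List B} (i : ℕ) {x : A} →
                 Pointwise R xs ys → xs !? i ≡ just x → ∃[ y ] ys !? i ≡ just y × R x y
  Pointwise-!? zero    (r ∷ _)  refl = _ , refl , r
  Pointwise-!? (suc i) (_ ∷ rs) eq   = Pointwise-!? i rs eq

  Pointwise-take : {xs : List A} {ys : List B} (i : ℕ) → Pointwise R xs ys → Pointwise R (take i xs) (take i ys)
  Pointwise-take zero    _        = []
  Pointwise-take (suc i) []       = []
  Pointwise-take (suc i) (r ∷ rs) = r ∷ Pointwise-take i rs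

module _ {A B : Set} (f : A → B) {P : B → Set} (P? : ∀ y → Dec (P y)) where

  filter-map : (xs : List A) → filter P? (map f xs) ≡ map f (filter (P? ∘ f) xs)
  filter-map []       = refl
  filter-map (x ∷ xs) with P? (f x)
  ... | yes _ = cong (f x ∷_) (filter-map xs)
  ... | no  _ = filter-map xs

module _ {A : Set} {P : A → Set} {R : A → A → Set}
         (trans-on : ∀ {x y z} → P y → P z → R x y → R y z → R x z) where

  Linked⇒All-on : ∀ {x y ys} → All P (y ∷ ys) → R x y → Linked R (y ∷ ys) → All (R x) (y ∷ ys)
  Linked⇒All-on (_ ∷ [])       Rxy [-]         = Rxy ∷ []
  Linked⇒All-on (py ∷ pz ∷ ps) Rxy (Ryz ∷ Rzs) = Rxy ∷ Linked⇒All-on (pz ∷ ps) (trans-on py pz Rxy Ryz) Rzs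

  Linked⇒AllPairs-on : ∀ {xs} → All P xs → Linked R xs → AllPairs R xs
  Linked⇒AllPairs-on []        []          = []
  Linked⇒AllPairs-on (_ ∷ [])  [-]         = [] ∷ []
  Linked⇒AllPairs-on (_ ∷ ps)  (Rxy ∷ Rxs) = Linked⇒All-on ps Rxy Rxs ∷ Linked⇒AllPairs-on ps Rxs

module _ {A : Set} {R : A → A → Set} where

  AllPairs-before : (xs : List A) {v : A} {ys : List A} → AllPairs R (xs ++ v ∷ ys) → All (λ x → R x v) xs
  AllPairs-before []       _           = []
  AllPairs-before (x ∷ xs) (Rx ∷ Rxs) = All.head (AllP.++⁻ʳ xs Rx) ∷ AllPairs-before xs Rxs

  AllPairs-after : (xs : List A) {v : A} {ys : List A} → AllPairs R (xs ++ v ∷ ys) → All (R v) ys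
  AllPairs-after []       (Rv ∷ _)  = Rv
  AllPairs-after (x ∷ xs) (_ ∷ Rxs) = AllPairs-after xs Rxs

  AllPairs-!? : {xs : List A} {j k : ℕ} {x y : A} →
                AllPairs R xs → j < k → xs !? j ≡ just x → xs !? k ≡ just y → R x y
  AllPairs-!? {xs = _ ∷ xs} {zero} {suc k} (Rx ∷ _) _ refl eq = All-!? k Rx eq
  AllPairs-!? {j = suc j} {suc k} (_ ∷ Rxs) (s≤s j<k) ex ey = AllPairs-!? Rxs j<k ex ey

  AllPairs-!?-drop : {xs : List A} (k : ℕ) {x : A} →
                     AllPairs R xs → xs !? k ≡ just x → All (R x) (drop (suc k) xs)
  AllPairs-!?-drop zero    (Rx ∷ _)  refl = Rx
  AllPairs-!?-drop (suc k) (_ ∷ Rxs) eq   = AllPairs-!?-drop k Rxs eq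

module _ {A : Set} {P Q : A → Set} (P? : ∀ x → Dec (P x)) (Q? : ∀ x → Dec (Q x)) where

  length-filter-mono : ∀ {S : A → Set} {xs} → All S xs → (∀ {x} → S x → P x → Q x) →
                       length (filter P? xs) ≤ length (filter Q? xs)
  length-filter-mono []       P⇒Q = z≤n
  length-filter-mono {xs = x ∷ xs} (sx ∷ sxs) P⇒Q with P? x | Q? x
  ... | yes px | yes _  = s≤s (length-filter-mono sxs P⇒Q)
  ... | yes px | no ¬qx = contradiction (P⇒Q sx px) ¬qx
  ... | no  _  | yes _  = m≤n⇒m≤1+n (length-filter-mono sxs P⇒Q)
  ... | no  _  | no  _  = length-filter-mono sxs P⇒Q

-- For a strict weak order, two sorted lists that are permutations of each other have
-- incomparable elements at each position.
module SortedPermutation {A : Set} (Ok : A → Set) {_<_ : A → A → Set} (_<?_ : ∀ x y → Dec (x < y))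
  (<-irrefl : ∀ {x} → ¬ (x < x))
  (≮-trans : ∀ {x y z} → Ok y → Ok z → ¬ (y < x) → ¬ (z < y) → ¬ (z < x)) where

  Sorted : List A → Set
  Sorted = AllPairs (λ x y → ¬ (y < x))

  private
    #≮ #< : A → List A → ℕ
    #≮ v xs = length (filter (λ x → ¬? (v <? x)) xs)
    #< v xs = length (filter (_<? v) xs)

    #≮-position : (xs : List A) {v : A} {ys : List A} → Sorted (xs ++ v ∷ ys) → suc (length xs) ≤ #≮ v (xs ++ v ∷ ys)
    #≮-position xs {v} {ys} sorted = begin
        suc (length xs)                       ≤⟨ s≤s (m≤m+n (length xs) _) ⟩
        suc (length xs + #≮ v ys)             ≡⟨ +-suc (length xs) _ ⟨
        length xs + length (v ∷ filter ≮v? ys) ≡⟨ length-++ xs ⟨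
        length (xs ++ v ∷ filter ≮v? ys)      ≡⟨ cong length filter-eq ⟨
        #≮ v (xs ++ v ∷ ys)                   ∎
      where
      open ≤-Reasoning
      ≮v? = λ x → ¬? (v <? x)
      filter-eq : filter ≮v? (xs ++ v ∷ ys) ≡ xs ++ v ∷ filter ≮v? ys
      filter-eq = trans (filter-++ ≮v? xs (v ∷ ys))
                        (cong₂ _++_ (filter-all ≮v? (AllPairs-before xs sorted)) (filter-accept ≮v? <-irrefl))

    #<-position : (xs : List A) {w : A} {ys : List A} → Sorted (xs ++ w ∷ ys) → #< w (xs ++ w ∷ ys) ≤ length xs
    #<-position xs {w} {ys} sorted = begin
        #< w (xs ++ w ∷ ys)                                 ≡⟨ cong length (filter-++ (_<? w) xs (w ∷ ys)) ⟩
        length (filter (_<? w) xs ++ filter (_<? w) (w ∷ ys)) ≡⟨ cong (λ zs → length (filter (_<? w) xs ++ zs)) none ⟩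
        length (filter (_<? w) xs ++ [])                    ≡⟨ cong length (++-identityʳ (filter (_<? w) xs)) ⟩
        #< w xs                                             ≤⟨ length-filter (_<? w) xs ⟩
        length xs                                           ∎
      where
      open ≤-Reasoning
      none : filter (_<? w) (w ∷ ys) ≡ []
      none = filter-none (_<? w) (<-irrefl ∷ AllPairs-after xs sorted)

  sorted-↭-≮ : (xs₁ : List A) {v : A} {ys₁ : List A} (xs₂ : List A) {w : A} {ys₂ : List A} →
    All Ok (xs₁ ++ v ∷ ys₁) → Sorted (xs₁ ++ v ∷ ys₁) → Sorted (xs₂ ++ w ∷ ys₂) →
    (xs₁ ++ v ∷ ys₁) ↭ (xs₂ ++ w ∷ ys₂) → length xs₁ ≡ length xs₂ → ¬ (v < w)
  sorted-↭-≮ xs₁ {v} {ys₁} xs₂ {w} {ys₂} ok sorted₁ sorted₂ l₁↭l₂ |xs₁|≡|xs₂| v<w = n≮n (length xs₁) (begin-strict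
      length xs₁                     <⟨ #≮-position xs₁ sorted₁ ⟩
      #≮ v (xs₁ ++ v ∷ ys₁)          ≤⟨ length-filter-mono (λ x → ¬? (v <? x)) (_<? w) ok ≮v⇒<w ⟩
      #< w (xs₁ ++ v ∷ ys₁)          ≡⟨ ↭-length (filter-↭ (_<? w) l₁↭l₂) ⟩
      #< w (xs₂ ++ w ∷ ys₂)          ≤⟨ #<-position xs₂ sorted₂ ⟩
      length xs₂                     ≡⟨ |xs₁|≡|xs₂| ⟨
      length xs₁                     ∎)
    where
    open ≤-Reasoning
    ok-v : Ok v
    ok-v = All.head (AllP.++⁻ʳ xs₁ ok)
    ≮v⇒<w : ∀ {x} → Ok x → ¬ (v < x) → x < w
    ≮v⇒<w {x} ok-x v≮x with x <? w
    ... | yes x<w = x<w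
    ... | no  x≮w = contradiction v<w (≮-trans ok-x ok-v x≮w v≮x)

-- Rotations

module _ {σ : ℕ} where

  rot-∷ʳ : (xs : Word σ) (c : Fin σ) → rot (xs ∷ʳ c) ≡ c ∷ xs
  rot-∷ʳ xs c with reverse (xs ∷ʳ c) | reverse-++ xs (c ∷ [])
  ... | .(c ∷ reverse xs) | refl = cong (c ∷_) (reverse-involutive xs)

  rot^-++ : (xs ys : Word σ) → rot^ (length ys) (xs ++ ys) ≡ ys ++ xs
  rot^-++ xs []       = ++-identityʳ xs
  rot^-++ xs (y ∷ ys) = begin
      rot (rot^ (length ys) (xs ++ y ∷ ys))   ≡⟨ cong (rot ∘′ rot^ (length ys)) (sym (++-assoc xs (y ∷ []) ys)) ⟩
      rot (rot^ (length ys) ((xs ∷ʳ y) ++ ys)) ≡⟨ cong rot (rot^-++ (xs ∷ʳ y) ys) ⟩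
      rot (ys ++ xs ∷ʳ y)                      ≡⟨ cong rot (sym (++-assoc ys xs (y ∷ []))) ⟩
      rot ((ys ++ xs) ∷ʳ y)                    ≡⟨ rot-∷ʳ (ys ++ xs) y ⟩
      y ∷ ys ++ xs                             ∎
    where open ≡-Reasoning

  rot^-length : (xs : Word σ) → rot^ (length xs) xs ≡ xs
  rot^-length xs = trans (rot^-++ [] xs) (++-identityʳ xs)

  rot^-concat : {us U₁ U₂ : List (Word σ)} {u : Word σ} → us ≡ U₁ ++ u ∷ U₂ →
                rot^ (length (u ++ concat U₂)) (concat us) ≡ u ++ concat U₂ ++ concat U₁
  rot^-concat {us} {U₁} {U₂} {u} us≡ = begin
      rot^ k (concat us)                     ≡⟨ cong (rot^ k ∘ concat) us≡ ⟩
      rot^ k (concat (U₁ ++ u ∷ U₂))         ≡⟨ cong (rot^ k) (concat-++ U₁ (u ∷ U₂)) ⟨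
      rot^ k (concat U₁ ++ u ++ concat U₂)   ≡⟨ rot^-++ (concat U₁) (u ++ concat U₂) ⟩
      (u ++ concat U₂) ++ concat U₁          ≡⟨ ++-assoc u (concat U₂) (concat U₁) ⟩
      u ++ concat U₂ ++ concat U₁            ∎
    where
    open ≡-Reasoning
    k = length (u ++ concat U₂)

  length-rot : (xs : Word σ) → length (rot xs) ≡ length xs
  length-rot xs with reverseView xs
  ... | []             = refl
  ... | ys ∶ _ ∶ʳ c rewrite rot-∷ʳ ys c | length-++ ys {c ∷ []} | +-comm (length ys) 1 = refl

  length-rot^ : (k : ℕ) (xs : Word σ) → length (rot^ k xs) ≡ length xs
  length-rot^ zero    xs = refl
  length-rot^ (suc k) xs = trans (length-rot (rot^ k xs)) (length-rot^ k xs)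

  head-rot : (xs : Word σ) → head (rot xs) ≡ last xs
  head-rot xs with reverseView xs
  ... | []            = refl
  ... | ys ∶ _ ∶ʳ c rewrite rot-∷ʳ ys c | last-∷ʳ ys c = refl

  at≡just : (xs : Word σ) (k : ℕ) {c : Fin σ} → at xs k ≡ just c → ∃[ k′ ] (k ≡ suc k′ × xs !? k′ ≡ just c)
  at≡just xs (suc k) e = k , refl , e

  at-length-∷ʳ : (xs : Word σ) (c : Fin σ) → at (xs ∷ʳ c) (length (xs ∷ʳ c)) ≡ just c
  at-length-∷ʳ xs c rewrite length-++ xs {c ∷ []} | +-comm (length xs) 1 = !?-middle xs [] c

-- Infinite powers and the ω-order

module _ {σ : ℕ} where

  _≟ᴹ_ : (m n : Maybe (Fin σ)) → Dec (m ≡ n)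
  _≟ᴹ_ = MaybeP.≡-dec FinP._≟_

  ω-at-pow : (xs : Word σ) (m : ℕ) {j : ℕ} → j < length (pow m xs) → ω-at xs j ≡ pow m xs !? j
  ω-at-pow xs m {j} j<n = begin
      pow (suc j) xs !? j                      ≡⟨ !?-++ˡ (pow (suc j) xs) (pow m xs) j<pow ⟨
      (pow (suc j) xs ++ pow m xs) !? j        ≡⟨ cong (_!? j) (pow-+ (suc j) m xs) ⟨
      pow (suc j + m) xs !? j                  ≡⟨ cong (λ k → pow k xs !? j) (+-comm (suc j) m) ⟩
      pow (m + suc j) xs !? j                  ≡⟨ cong (_!? j) (pow-+ m (suc j) xs) ⟩
      (pow m xs ++ pow (suc j) xs) !? j        ≡⟨ !?-++ˡ (pow m xs) (pow (suc j) xs) j<n ⟩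
      pow m xs !? j                            ∎
    where
    open ≡-Reasoning
    j<pow : j < length (pow (suc j) xs)
    j<pow = <-length-pow (suc j) xs (nonempty-pow m xs j<n) ≤-refl

  ω-at-< : (xs : Word σ) {j : ℕ} → j < length xs → ω-at xs j ≡ xs !? j
  ω-at-< xs {j} j<n = trans (ω-at-pow xs 1 (subst (λ ys → j < length ys) (sym (++-identityʳ xs)) j<n))
                        (cong (_!? j) (++-identityʳ xs))

  ω-at-0 : (xs : Word σ) → ω-at xs 0 ≡ head xs
  ω-at-0 xs = cong head (++-identityʳ xs)

  ω-at-[] : (j : ℕ) → ω-at {σ} [] j ≡ nothing
  ω-at-[] j = cong head (trans (cong (drop j) (pow-[] (suc j))) (drop-[] j))
    where
    pow-[] : (m : ℕ) → pow {Fin σ} m [] ≡ []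
    pow-[] zero    = refl
    pow-[] (suc m) = pow-[] m

  ω-at-defined : (xs : Word σ) (j : ℕ) → 0 < length xs → ∃[ c ] ω-at xs j ≡ just c
  ω-at-defined xs j 0<n = !?-defined (pow (suc j) xs) (<-length-pow (suc j) xs 0<n ≤-refl)

  ω-at-periodic : (xs : Word σ) (j : ℕ) → ω-at xs (length xs + j) ≡ ω-at xs j
  ω-at-periodic []      j = refl
  ω-at-periodic xs@(_ ∷ _) j = begin
      ω-at xs (length xs + j)                        ≡⟨ ω-at-pow xs (suc (suc j)) bound ⟩
      (xs ++ pow (suc j) xs) !? (length xs + j)     ≡⟨ !?-++ʳ xs (pow (suc j) xs) j ⟩
      pow (suc j) xs !? j                            ∎
    where
    open ≡-Reasoning
    bound : length xs + j < length (xs ++ pow (suc j) xs)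
    bound = subst (length xs + j <_) (sym (length-++ xs))
              (+-monoʳ-< (length xs) (<-length-pow (suc j) xs (s≤s z≤n) ≤-refl))

  ω-at-periodic* : (xs : Word σ) (k j : ℕ) → ω-at xs (k * length xs + j) ≡ ω-at xs j
  ω-at-periodic* xs zero    j = refl
  ω-at-periodic* xs (suc k) j = begin
      ω-at xs (length xs + k * length xs + j)   ≡⟨ cong (ω-at xs) (+-assoc (length xs) (k * length xs) j) ⟩
      ω-at xs (length xs + (k * length xs + j)) ≡⟨ ω-at-periodic xs (k * length xs + j) ⟩
      ω-at xs (k * length xs + j)               ≡⟨ ω-at-periodic* xs k j ⟩
      ω-at xs j                                 ∎
    where open ≡-Reasoning

  ω-at-mod : (xs : Word σ) (N : ℕ) .{{_ : NonZero N}} → length xs ∣ N → (j : ℕ) →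
             ω-at xs j ≡ ω-at xs (j % N)
  ω-at-mod xs N (divides q N≡q*n) j = begin
      ω-at xs j                                 ≡⟨ cong (ω-at xs) (m≡m%n+[m/n]*n j N) ⟩
      ω-at xs (j % N + (j / N) * N)             ≡⟨ cong (ω-at xs) (+-comm (j % N) _) ⟩
      ω-at xs ((j / N) * N + j % N)             ≡⟨ cong (λ k → ω-at xs ((j / N) * k + j % N)) N≡q*n ⟩
      ω-at xs ((j / N) * (q * length xs) + j % N) ≡⟨ cong (λ k → ω-at xs (k + j % N)) (sym (*-assoc (j / N) q _)) ⟩
      ω-at xs ((j / N) * q * length xs + j % N) ≡⟨ ω-at-periodic* xs ((j / N) * q) (j % N) ⟩
      ω-at xs (j % N)                           ∎
    where open ≡-Reasoning

  ω-at-rot : (xs : Word σ) (j : ℕ) → ω-at (rot xs) (suc j) ≡ ω-at xs j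
  ω-at-rot xs j with reverseView xs
  ... | []           = trans (ω-at-[] (suc j)) (sym (ω-at-[] j))
  ... | ys ∶ _ ∶ʳ c rewrite rot-∷ʳ ys c = begin
      ω-at (c ∷ ys) (suc j)                              ≡⟨ ω-at-pow (c ∷ ys) (suc (suc j)) bound ⟩
      pow (suc (suc j)) (c ∷ ys) !? suc j                ≡⟨ cong (_!? suc j) (pow-∷ (suc j) c ys) ⟩
      (pow (suc j) (ys ∷ʳ c) ++ ys) !? j                 ≡⟨ !?-++ˡ (pow (suc j) (ys ∷ʳ c)) ys bound′ ⟩
      pow (suc j) (ys ∷ʳ c) !? j                         ∎
    where
    open ≡-Reasoning
    bound : suc j < length (pow (suc (suc j)) (c ∷ ys))
    bound = <-length-pow (suc (suc j)) (c ∷ ys) (s≤s z≤n) ≤-refl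
    bound′ : j < length (pow (suc j) (ys ∷ʳ c))
    bound′ = <-length-pow (suc j) (ys ∷ʳ c) (subst (0 <_) (sym (length-++ ys)) (m≤n+m 1 (length ys))) ≤-refl

  AgreeBelow : ℕ → Word σ → Word σ → Set
  AgreeBelow m xs ys = ∀ j → j < m → ω-at xs j ≡ ω-at ys j

  _≈ω_ : Word σ → Word σ → Set
  xs ≈ω ys = ∀ j → ω-at xs j ≡ ω-at ys j

  _⪯ω_ : Word σ → Word σ → Set
  xs ⪯ω ys = ¬ (ys ≺ω xs)

  ≺ω-irrefl : (xs : Word σ) → ¬ (xs ≺ω xs)
  ≺ω-irrefl xs (_ , _ , p , q , ep , eq , p<q) = FinP.<-irrefl (just-injective (trans (sym ep) eq)) p<q

  ≺ω-resp-≈ω : {xs xs′ ys ys′ : Word σ} → xs ≈ω xs′ → ys ≈ω ys′ → xs ≺ω ys → xs′ ≺ω ys′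
  ≺ω-resp-≈ω xs≈ ys≈ (m , agree , p , q , ep , eq , p<q) =
    m , (λ j j<m → trans (sym (xs≈ j)) (trans (agree j j<m) (ys≈ j))) ,
    p , q , trans (sym (xs≈ m)) ep , trans (sym (ys≈ m)) eq , p<q

  ≺ω-trans : {xs ys zs : Word σ} → xs ≺ω ys → ys ≺ω zs → xs ≺ω zs
  ≺ω-trans (m₁ , agree₁ , p₁ , q₁ , ep₁ , eq₁ , lt₁) (m₂ , agree₂ , p₂ , q₂ , ep₂ , eq₂ , lt₂)
    with <-cmp m₁ m₂
  ... | tri< m₁<m₂ _ _ =
    m₁ , (λ j j<m → trans (agree₁ j j<m) (agree₂ j (<-trans j<m m₁<m₂))) ,
    p₁ , q₁ , ep₁ , trans (sym (agree₂ m₁ m₁<m₂)) eq₁ , lt₁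
  ... | tri≈ _ refl _ =
    m₁ , (λ j j<m → trans (agree₁ j j<m) (agree₂ j j<m)) ,
    p₁ , q₂ , ep₁ , eq₂ , FinP.<-trans lt₁ (subst (Fin._< q₂) (just-injective (trans (sym ep₂) eq₁)) lt₂)
  ... | tri> _ _ m₂<m₁ =
    m₂ , (λ j j<m → trans (agree₁ j (<-trans j<m m₂<m₁)) (agree₂ j j<m)) ,
    p₂ , q₂ , trans (agree₁ m₂ m₂<m₁) ep₂ , eq₂ , lt₂

  ≺ω-asym : {xs ys : Word σ} → xs ≺ω ys → ¬ (ys ≺ω xs)
  ≺ω-asym {xs} xs≺ys ys≺xs = ≺ω-irrefl xs (≺ω-trans xs≺ys ys≺xs)

  ≺ω-[]ˡ : (ys : Word σ) → ¬ ([] ≺ω ys)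
  ≺ω-[]ˡ ys (m , _ , _ , _ , e , _) with trans (sym (ω-at-[] m)) e
  ... | ()

  ≺ω-[]ʳ : (xs : Word σ) → ¬ (xs ≺ω [])
  ≺ω-[]ʳ xs (m , _ , _ , _ , _ , e , _) with trans (sym (ω-at-[] m)) e
  ... | ()

  agreeBelow-or-mismatch : (xs ys : Word σ) (N : ℕ) →
    AgreeBelow N xs ys ⊎ ∃[ m ] (AgreeBelow m xs ys × ω-at xs m ≢ ω-at ys m)
  agreeBelow-or-mismatch xs ys zero = inj₁ (λ _ ())
  agreeBelow-or-mismatch xs ys (suc N) with agreeBelow-or-mismatch xs ys N
  ... | inj₂ mismatch = inj₂ mismatch
  ... | inj₁ agree with ω-at xs N ≟ᴹ ω-at ys N
  ...   | no  xs≢ys = inj₂ (N , agree , xs≢ys)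
  ...   | yes xs≡ys = inj₁ agree′
    where
    agree′ : AgreeBelow (suc N) xs ys
    agree′ j (s≤s j≤N) with m≤n⇒m<n∨m≡n j≤N
    ... | inj₁ j<N  = agree j j<N
    ... | inj₂ refl = xs≡ys

  ω-mismatch⇒comparable : (xs ys : Word σ) {m : ℕ} → 0 < length xs → 0 < length ys →
    AgreeBelow m xs ys → ω-at xs m ≢ ω-at ys m → xs ≺ω ys ⊎ ys ≺ω xs
  ω-mismatch⇒comparable xs ys {m} 0<xs 0<ys agree xs≢ys
    with ω-at-defined xs m 0<xs | ω-at-defined ys m 0<ys
  ... | p , ep | q , eq with FinP.<-cmp p q
  ... | tri< p<q _ _  = inj₁ (m , agree , p , q , ep , eq , p<q)
  ... | tri≈ _ refl _ = contradiction (trans ep (sym eq)) xs≢ys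
  ... | tri> _ _ q<p  = inj₂ (m , (λ j j<m → sym (agree j j<m)) , q , p , eq , ep , q<p)

  ⪯ω-antisym : (xs ys : Word σ) → 0 < length xs → 0 < length ys → xs ⪯ω ys → ys ⪯ω xs → xs ≈ω ys
  ⪯ω-antisym xs ys 0<xs 0<ys xs⪯ys ys⪯xs j with agreeBelow-or-mismatch xs ys (suc j)
  ... | inj₁ agree = agree j ≤-refl
  ... | inj₂ (m , agree , xs≢ys) with ω-mismatch⇒comparable xs ys 0<xs 0<ys agree xs≢ys
  ...   | inj₁ xs≺ys = contradiction xs≺ys ys⪯xs
  ...   | inj₂ ys≺xs = contradiction ys≺xs xs⪯ys

  agreeBelow⇒≈ω : (xs ys : Word σ) → 0 < length xs → 0 < length ys →
                  AgreeBelow (length xs * length ys) xs ys → xs ≈ω ys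
  agreeBelow⇒≈ω xs ys 0<xs 0<ys agree j = begin
      ω-at xs j       ≡⟨ ω-at-mod xs N (m∣m*n (length ys)) j ⟩
      ω-at xs (j % N) ≡⟨ agree _ (m%n<n j N) ⟩
      ω-at ys (j % N) ≡⟨ ω-at-mod ys N (n∣m*n (length xs)) j ⟨
      ω-at ys j       ∎
    where
    open ≡-Reasoning
    N = length xs * length ys
    instance _ = m*n≢0 (length xs) (length ys) {{>-nonZero 0<xs}} {{>-nonZero 0<ys}}

  _≺ω?_ : (xs ys : Word σ) → Dec (xs ≺ω ys)
  []         ≺ω? ys = no (≺ω-[]ˡ ys)
  xs@(_ ∷ _) ≺ω? [] = no (≺ω-[]ʳ xs)
  xs@(_ ∷ _) ≺ω? ys@(_ ∷ _) with agreeBelow-or-mismatch xs ys (length xs * length ys)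
  ... | inj₁ agree =
    no (λ xs≺ys → ≺ω-irrefl xs (≺ω-resp-≈ω (λ _ → refl) (sym ∘ agreeBelow⇒≈ω xs ys (s≤s z≤n) (s≤s z≤n) agree) xs≺ys))
  ... | inj₂ (m , agree , xs≢ys) with ω-mismatch⇒comparable xs ys (s≤s z≤n) (s≤s z≤n) agree xs≢ys
  ...   | inj₁ xs≺ys = yes xs≺ys
  ...   | inj₂ ys≺xs = no (≺ω-asym ys≺xs)

  ⪯ω-trans : (xs ys zs : Word σ) → 0 < length ys → 0 < length zs → xs ⪯ω ys → ys ⪯ω zs → xs ⪯ω zs
  ⪯ω-trans xs ys zs 0<ys 0<zs xs⪯ys ys⪯zs zs≺xs with ys ≺ω? zs
  ... | yes ys≺zs = xs⪯ys (≺ω-trans ys≺zs zs≺xs)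
  ... | no  ys⋠zs = xs⪯ys (≺ω-resp-≈ω (sym ∘ ⪯ω-antisym ys zs 0<ys 0<zs ys⪯zs ys⋠zs) (λ _ → refl) zs≺xs)

  rot-mono-⪯ω : {xs ys : Word σ} → last xs ≡ last ys → xs ⪯ω ys → rot xs ⪯ω rot ys
  rot-mono-⪯ω {xs} {ys} same-last xs⪯ys (zero , _ , p , q , ep , eq , p<q) =
    FinP.<-irrefl (just-injective (begin
      just p               ≡⟨ trans (sym ep) (ω-at-0 (rot ys)) ⟩
      head (rot ys)        ≡⟨ trans (head-rot ys) (sym same-last) ⟩
      last xs              ≡⟨ trans (sym (head-rot xs)) (sym (ω-at-0 (rot xs))) ⟩
      ω-at (rot xs) 0      ≡⟨ eq ⟩
      just q               ∎)) p<q
    where open ≡-Reasoning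
  rot-mono-⪯ω {xs} {ys} same-last xs⪯ys (suc m , agree , p , q , ep , eq , p<q) =
    xs⪯ys (m , (λ j j<m → trans (sym (ω-at-rot ys j)) (trans (agree (suc j) (s≤s j<m)) (ω-at-rot xs j))) ,
           p , q , trans (sym (ω-at-rot ys m)) ep , trans (sym (ω-at-rot xs m)) eq , p<q)

  map-rot-sorted : {c : Fin σ} {xs : List (Word σ)} → All (λ t → head (rot t) ≡ just c) xs →
                   AllPairs _⪯ω_ xs → AllPairs _⪯ω_ (map rot xs)
  map-rot-sorted []         []         = []
  map-rot-sorted {xs = x ∷ _} (ex ∷ exs) (rx ∷ rxs) =
    AllP.map⁺ (All.zipWith (λ {y} (ey , r) → rot-mono-⪯ω (same-last y (trans ey (sym ex))) r) (exs , rx)) ∷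
    map-rot-sorted exs rxs
    where
    same-last : ∀ y → head (rot y) ≡ head (rot x) → last x ≡ last y
    same-last y ey = trans (sym (head-rot x)) (trans (sym ey) (head-rot y))

  Mismatch : ℕ → Word σ → Word σ → Set
  Mismatch m xs ys = (∀ j → j < m → xs !? j ≡ ys !? j) ×
                     ∃₂ λ p q → xs !? m ≡ just p × ys !? m ≡ just q × p Fin.< q

  Mismatch-respˡ : {xs ys zs : Word σ} {m : ℕ} → (∀ {j} → j ≤ m → zs !? j ≡ xs !? j) →
                   Mismatch m xs ys → Mismatch m zs ys
  Mismatch-respˡ zs≈xs (agree , p , q , ep , eq , p<q) =
    (λ j j<m → trans (zs≈xs (<⇒≤ j<m)) (agree j j<m)) , p , q , trans (zs≈xs ≤-refl) ep , eq , p<q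

  ≺-mismatch : {xs ys : Word σ} → xs ≺ ys → length ys ≤ length xs → ∃[ m ] (m < length ys × Mismatch m xs ys)
  ≺-mismatch (here {a} {b} a<b) _ = 0 , s≤s z≤n , (λ _ ()) , a , b , refl , refl , a<b
  ≺-mismatch (there xs≺ys) (s≤s n≤m) with ≺-mismatch xs≺ys n≤m
  ... | m , m<n , agree , mismatch = suc m , s≤s m<n , agree′ , mismatch
    where
    agree′ : ∀ j → j < suc m → _
    agree′ zero    _         = refl
    agree′ (suc j) (s≤s j<m) = agree j j<m

  mismatch⇒≺ : (xs ys : Word σ) (m : ℕ) → Mismatch m xs ys → xs ≺ ys
  mismatch⇒≺ (x ∷ xs) (y ∷ ys) zero    (_ , _ , _ , refl , refl , x<y) = here x<y
  mismatch⇒≺ (x ∷ xs) (y ∷ ys) (suc m) (agree , mismatch) with agree 0 (s≤s z≤n)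
  ... | refl = there (mismatch⇒≺ xs ys m ((λ j j<m → agree (suc j) (s≤s j<m)) , mismatch))

  ≺-++ʳ : {xs ys : Word σ} (zs : Word σ) → xs ≺ ys → length ys ≤ length xs → xs ≺ (ys ++ zs)
  ≺-++ʳ zs (here x<y)    _         = here x<y
  ≺-++ʳ zs (there xs≺ys) (s≤s n≤m) = there (≺-++ʳ zs xs≺ys n≤m)

  ≺⇒≺ω : {xs ys : Word σ} → xs ≺ ys → length ys ≤ length xs → xs ≺ω ys
  ≺⇒≺ω {xs} {ys} xs≺ys n≤m with ≺-mismatch xs≺ys n≤m
  ... | m , m<n , agree , p , q , ep , eq , p<q =
    m , (λ j j<m → on-prefix (<-trans j<m m<n) (agree j j<m)) ,
    p , q , trans (ω-at-< xs (<-≤-trans m<n n≤m)) ep , trans (ω-at-< ys m<n) eq , p<q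
    where
    on-prefix : ∀ {j} → j < length ys → xs !? j ≡ ys !? j → ω-at xs j ≡ ω-at ys j
    on-prefix j<n e = trans (ω-at-< xs (<-≤-trans j<n n≤m)) (trans e (sym (ω-at-< ys j<n)))

  Lyndon⇒≺ω-rot^ : (u : Word σ) {t : ℕ} → Lyndon u → 0 < t → t < length u → u ≺ω rot^ t u
  Lyndon⇒≺ω-rot^ u {t} (_ , u≺suffixes) 0<t t<n =
    subst (u ≺ω_) (sym rot^t-u) (≺⇒≺ω (≺-++ʳ T (u≺suffixes k 1≤k k<n) |D|≤n) (≤-reflexive |D++T|))
    where
    k = length u ∸ t
    D = drop k u
    T = take k u
    |D|≡t : length D ≡ t
    |D|≡t = trans (length-drop k u) (m∸[m∸n]≡n (<⇒≤ t<n))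
    rot^t-u : rot^ t u ≡ D ++ T
    rot^t-u = trans (cong₂ rot^ (sym |D|≡t) (sym (take++drop≡id k u))) (rot^-++ T D)
    1≤k : 1 ≤ k
    1≤k = m<n⇒0<n∸m t<n
    k<n : k < length u
    k<n = ∸-monoʳ-< 0<t (<⇒≤ t<n)
    |D|≤n : length D ≤ length u
    |D|≤n = subst (_≤ length u) (sym |D|≡t) (<⇒≤ t<n)
    |D++T| : length (D ++ T) ≡ length u
    |D++T| = trans (cong length (sym rot^t-u)) (length-rot^ t u)

  ∈-rotations : (us : List (Word σ)) {s : Word σ} → s ∈ concatMap rotations us →
                ∃₂ λ u t → u ∈ us × t < length u × s ≡ rot^ t u
  ∈-rotations us s∈ with Membership.find (∈-concatMap⁻ rotations s∈)
  ... | u , u∈us , s∈rots with ∈-map⁻ (λ k → rot^ k u) s∈rots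
  ...   | t , t∈ , s≡ = u , t , u∈us , ∈-upTo⁻ t∈ , s≡

  ∈-rotations⁺ : (us : List (Word σ)) {u : Word σ} → u ∈ us → 0 < length u → u ∈ concatMap rotations us
  ∈-rotations⁺ us u∈us 0<n = ∈-concatMap⁺ rotations (Any.map (λ { refl → ∈-map⁺ (λ k → rot^ k _) (∈-upTo⁺ 0<n) }) u∈us)

  map-rot-rotations : (u : Word σ) → map rot (rotations u) ↭ rotations u
  map-rot-rotations u = begin
      map rot (map g (upTo n))     ≡⟨ cong (map rot) (map-applyUpTo id g n) ⟩
      map rot (applyUpTo g n)      ≡⟨ map-applyUpTo g rot n ⟩
      applyUpTo (g ∘ suc) n        ↭⟨ shift n (rot^-length u) ⟩
      applyUpTo g n                ≡⟨ map-applyUpTo id g n ⟨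
      map g (upTo n)               ∎
    where
    open PermutationReasoning
    n = length u
    g : ℕ → Word σ
    g k = rot^ k u
    shift : (m : ℕ) → g m ≡ u → applyUpTo (g ∘ suc) m ↭ applyUpTo g m
    shift zero    _     = ↭-refl
    shift (suc m) g-m≡u = begin
      applyUpTo (g ∘ suc) (suc m)          ≡⟨ applyUpTo-∷ʳ (g ∘ suc) m ⟨
      applyUpTo (g ∘ suc) m ∷ʳ g (suc m)   ≡⟨ cong (applyUpTo (g ∘ suc) m ∷ʳ_) g-m≡u ⟩
      applyUpTo (g ∘ suc) m ∷ʳ u           ↭⟨ ∷↭∷ʳ u _ ⟨
      u ∷ applyUpTo (g ∘ suc) m            ∎

-- Letter counts and sorted words

module _ {σ : ℕ} where

  count-++ : (c : Fin σ) (xs ys : Word σ) → count c (xs ++ ys) ≡ count c xs + count c ys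
  count-++ c xs ys = trans (cong length (filter-++ (Fin._≟ c) xs ys)) (length-++ (filter (Fin._≟ c) xs))

  count-∷-≢ : {c d : Fin σ} (xs : Word σ) → d ≢ c → count c (d ∷ xs) ≡ count c xs
  count-∷-≢ {c} {d} xs d≢c with d Fin.≟ c
  ... | yes d≡c = contradiction d≡c d≢c
  ... | no  _   = refl

  count-rot : (c : Fin σ) (xs : Word σ) → count c (rot xs) ≡ count c xs
  count-rot c xs with reverseView xs
  ... | []            = refl
  ... | ys ∶ _ ∶ʳ d rewrite rot-∷ʳ ys d =
    trans (count-++ c (d ∷ []) ys) (trans (+-comm (count c (d ∷ [])) _) (sym (count-++ c ys (d ∷ []))))

  count-pos : (xs : Word σ) (k : ℕ) {c : Fin σ} → xs !? k ≡ just c → 0 < count c xs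
  count-pos xs k {c} xs-k = subst (λ ys → 0 < count c ys) (take-!?-drop xs k xs-k)
                                  (filter-some (Fin._≟ c) (AnyP.++⁺ʳ (take k xs) (here refl)))

  count-drop : (xs ys : Word σ) (k : ℕ) (c : Fin σ) → count c xs ≡ count c ys → take k xs ≡ take k ys →
               count c (drop k xs) ≡ count c (drop k ys)
  count-drop xs ys k c same-count same-prefix = +-cancelˡ-≡ (count c (take k xs)) _ _ (begin
      count c (take k xs) + count c (drop k xs) ≡⟨ count-++ c (take k xs) (drop k xs) ⟨
      count c (take k xs ++ drop k xs)          ≡⟨ cong (count c) (take++drop≡id k xs) ⟩
      count c xs                                ≡⟨ same-count ⟩
      count c ys                                ≡⟨ cong (count c) (take++drop≡id k ys) ⟨
      count c (take k ys ++ drop k ys)          ≡⟨ count-++ c (take k ys) (drop k ys) ⟩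
      count c (take k ys) + count c (drop k ys) ≡⟨ cong (λ zs → count c zs + count c (drop k ys)) same-prefix ⟨
      count c (take k xs) + count c (drop k ys) ∎)
    where open ≡-Reasoning

  count-Pointwise : {A : Set} (f : A → Maybe (Fin σ)) (c : Fin σ) {xs : List A} {cs : Word σ} →
                    Pointwise (λ x d → f x ≡ just d) xs cs → length (filter (λ x → f x ≟ᴹ just c) xs) ≡ count c cs
  count-Pointwise f c []                       = refl
  count-Pointwise f c {x ∷ _} {d ∷ _} (fx≡d ∷ rs) with f x ≟ᴹ just c | d Fin.≟ c
  ... | yes _      | yes _   = cong suc (count-Pointwise f c rs)
  ... | yes fx≡c   | no  d≢c = contradiction (just-injective (trans (sym fx≡d) fx≡c)) d≢c
  ... | no  fx≢c   | yes refl = contradiction fx≡d fx≢c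
  ... | no  _      | no  _   = count-Pointwise f c rs

  Pointwise-just : {A : Set} (f : A → Maybe (Fin σ)) {xs : List A} →
                   All (λ x → ∃[ d ] f x ≡ just d) xs → ∃[ cs ] Pointwise (λ x d → f x ≡ just d) xs cs
  Pointwise-just f []              = [] , []
  Pointwise-just f ((d , e) ∷ des) with Pointwise-just f des
  ... | cs , rs = d ∷ cs , e ∷ rs

  count-replicate-zero : (k : ℕ) → count {suc σ} Fin.zero (replicate k Fin.zero) ≡ k
  count-replicate-zero zero    = refl
  count-replicate-zero (suc k) = cong suc (count-replicate-zero k)

  count-replicate-suc : (c : Fin σ) (k : ℕ) → count (Fin.suc c) (replicate k Fin.zero) ≡ 0
  count-replicate-suc c zero    = refl
  count-replicate-suc c (suc k) = count-replicate-suc c k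

  count-map-suc-zero : (xs : Word σ) → count Fin.zero (map Fin.suc xs) ≡ 0
  count-map-suc-zero []       = refl
  count-map-suc-zero (x ∷ xs) = count-map-suc-zero xs

  count-map-suc : (c : Fin σ) (xs : Word σ) → count (Fin.suc c) (map Fin.suc xs) ≡ count c xs
  count-map-suc c []       = refl
  count-map-suc c (x ∷ xs) with x Fin.≟ c
  ... | yes refl = cong suc (count-map-suc c xs)
  ... | no  x≢c  = count-map-suc c xs

  sortedWord-cong : (xs ys : Word σ) → (∀ c → count c xs ≡ count c ys) → sortedWord xs ≡ sortedWord ys
  sortedWord-cong xs ys same = concatMap-cong (λ c → cong (λ k → replicate k c) (same c)) (allFin σ)

  sorted-suc : (a : Fin σ) (xs : Word (suc σ)) → Linked Fin._≤_ (Fin.suc a ∷ xs) →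
               ∃[ ys ] (Fin.suc a ∷ xs ≡ map Fin.suc ys × Linked Fin._≤_ ys)
  sorted-suc a []             _          = a ∷ [] , refl , [-]
  sorted-suc a (Fin.suc b ∷ xs) (a≤b ∷ lk) with sorted-suc b xs lk
  ... | .b ∷ ys , refl , lk′ = a ∷ b ∷ ys , refl , s≤s⁻¹ a≤b ∷ lk′

  sorted-zeros-suc : (xs : Word (suc σ)) → Linked Fin._≤_ xs →
                     ∃₂ λ k ys → xs ≡ replicate k Fin.zero ++ map Fin.suc ys × Linked Fin._≤_ ys
  sorted-zeros-suc []               _  = 0 , [] , refl , []
  sorted-zeros-suc (Fin.zero ∷ xs)  lk with sorted-zeros-suc xs (Linked.tail lk)
  ... | k , ys , refl , lk′ = suc k , ys , refl , lk′
  sorted-zeros-suc (Fin.suc a ∷ xs) lk with sorted-suc a xs lk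
  ... | ys , eq , lk′ = 0 , ys , eq , lk′

sortedWord-sorted : (σ : ℕ) (xs : Word σ) → Linked Fin._≤_ xs → sortedWord xs ≡ xs
sortedWord-sorted zero    []  _ = refl
sortedWord-sorted (suc σ) xs sorted with sorted-zeros-suc xs sorted
... | k , ys , refl , sorted′ = begin
    run Fin.zero ++ concatMap run (tabulate Fin.suc)
      ≡⟨ cong (zeros++ ∘ concatMap run) (map-tabulate id Fin.suc) ⟨
    run Fin.zero ++ concatMap run (map Fin.suc (allFin σ))
      ≡⟨ cong zeros++ (concatMap-map run Fin.suc (allFin σ)) ⟩
    run Fin.zero ++ concatMap (run ∘ Fin.suc) (allFin σ)
      ≡⟨ cong zeros++ (concatMap-cong run-suc (allFin σ)) ⟩
    run Fin.zero ++ concatMap (map Fin.suc ∘ run′) (allFin σ)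
      ≡⟨ cong zeros++ (map-concatMap Fin.suc run′ (allFin σ)) ⟨
    run Fin.zero ++ map Fin.suc (sortedWord ys)
      ≡⟨ cong₂ (λ n zs → replicate n Fin.zero ++ map Fin.suc zs) #zero (sortedWord-sorted σ ys sorted′) ⟩
    replicate k Fin.zero ++ map Fin.suc ys
      ∎
  where
  open ≡-Reasoning
  xs′ = replicate k Fin.zero ++ map Fin.suc ys
  run : Fin (suc σ) → Word (suc σ)
  run c = replicate (count c xs′) c
  run′ : Fin σ → Word σ
  run′ c = replicate (count c ys) c
  zeros++ : Word (suc σ) → Word (suc σ)
  zeros++ = run Fin.zero ++_
  #zero : count Fin.zero xs′ ≡ k
  #zero = trans (count-++ Fin.zero (replicate k Fin.zero) (map Fin.suc ys))
                (trans (cong₂ _+_ (count-replicate-zero k) (count-map-suc-zero ys)) (+-identityʳ k))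
  run-suc : (c : Fin σ) → run (Fin.suc c) ≡ map Fin.suc (run′ c)
  run-suc c = trans (cong (λ n → replicate n (Fin.suc c)) #suc) (sym (map-replicate Fin.suc (count c ys) c))
    where
    #suc : count (Fin.suc c) xs′ ≡ count c ys
    #suc = trans (count-++ (Fin.suc c) (replicate k Fin.zero) (map Fin.suc ys))
                 (cong₂ _+_ (count-replicate-suc c k) (count-map-suc c ys))

module _ {σ : ℕ} where

  sorted-!?-≤ : {ys : Word σ} {j k : ℕ} {p q : Fin σ} → AllPairs Fin._≤_ ys → j ≤ k →
                ys !? j ≡ just p → ys !? k ≡ just q → p Fin.≤ q
  sorted-!?-≤ sorted j≤k ep eq with m≤n⇒m<n∨m≡n j≤k
  ... | inj₁ j<k  = AllPairs-!? sorted j<k ep eq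
  ... | inj₂ refl = ≤-reflexive (cong Fin.toℕ (just-injective (trans (sym ep) eq)))

  sorted-rearrangement-min : (xs ys : Word σ) (k : ℕ) {j : ℕ} {e c : Fin σ} →
    (∀ c → count c xs ≡ count c ys) → AllPairs Fin._≤_ ys → take k xs ≡ take k ys →
    k ≤ j → ys !? k ≡ just e → xs !? j ≡ just c → e Fin.≤ c
  sorted-rearrangement-min xs ys k {j} {e} {c} same-counts sorted same-prefix k≤j ye xc = ≮⇒≥ λ c<e →
    n≮n 0 (begin-strict
      0                        <⟨ count-pos (drop k xs) (j ∸ k) xc′ ⟩
      count c (drop k xs)      ≡⟨ count-drop xs ys k c (same-counts c) same-prefix ⟩
      count c (drop k ys)      ≡⟨ cong (count c) (drop-!? ys k ye) ⟩
      count c (e ∷ drop (suc k) ys) ≡⟨ cong length (filter-none (Fin._≟ c) (≢c c<e)) ⟩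
      0                        ∎)
    where
    open ≤-Reasoning
    xc′ : drop k xs !? (j ∸ k) ≡ just c
    xc′ = trans (!?-drop xs k (j ∸ k)) (trans (cong (xs !?_) (m+[n∸m]≡n k≤j)) xc)
    ≢c : c Fin.< e → All (_≢ c) (e ∷ drop (suc k) ys)
    ≢c c<e = (λ e≡c → FinP.<-irrefl (sym e≡c) c<e) ∷
             All.map (λ e≤d d≡c → <⇒≱ c<e (subst (e Fin.≤_) d≡c e≤d))
                     (AllPairs-!?-drop k sorted ye)

  lcp-≤ : (xs ys : Word σ) → lcp xs ys ≤ length xs
  lcp-≤ []       ys       = z≤n
  lcp-≤ (x ∷ xs) []       = z≤n
  lcp-≤ (x ∷ xs) (y ∷ ys) with x Fin.≟ y
  ... | yes _ = s≤s (lcp-≤ xs ys)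
  ... | no  _ = z≤n

  lcp-agree : (xs ys : Word σ) {j : ℕ} → j < lcp xs ys → xs !? j ≡ ys !? j
  lcp-agree (x ∷ xs) (y ∷ ys) {j} j<lcp with x Fin.≟ y
  lcp-agree (x ∷ xs) (.x ∷ ys) {zero}  _           | yes refl = refl
  lcp-agree (x ∷ xs) (.x ∷ ys) {suc j} (s≤s j<lcp) | yes refl = lcp-agree xs ys j<lcp

  lcp-mismatch : (xs ys : Word σ) {p q : Fin σ} → xs !? lcp xs ys ≡ just p → ys !? lcp xs ys ≡ just q → p ≢ q
  lcp-mismatch (x ∷ xs) (y ∷ ys) ep eq with x Fin.≟ y
  ... | yes _   = lcp-mismatch xs ys ep eq
  ... | no  x≢y = λ p≡q → x≢y (just-injective (trans ep (trans (cong just p≡q) (sym eq))))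

-- The rows of the BBWT matrix of w: all rotations of the Lyndon factors of w, sorted in ω-order,
-- with last column z = BBWT(w).
module BBWTMatrix {σ : ℕ} (us ss : List (Word σ)) (z : Word σ)
  (us-Lyndon : All Lyndon us) (ss↭ : ss ↭ concatMap rotations us)
  (ss-sorted : Linked _⪯ω_ ss) (last-column : Pointwise (λ s c → last s ≡ just c) ss z) where

  rows-nonempty : All (λ s → 0 < length s) ss
  rows-nonempty = All.tabulate (λ s∈ss → nonempty (∈-rotations us (∈-resp-↭ ss↭ s∈ss)))
    where
    nonempty : ∀ {s} → ∃₂ (λ u t → u ∈ us × t < length u × s ≡ rot^ t u) → 0 < length s
    nonempty (u , t , u∈us , _ , refl) = subst (0 <_) (sym (length-rot^ t u)) (proj₁ (All.lookup us-Lyndon u∈us))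

  rows-sorted : AllPairs _⪯ω_ ss
  rows-sorted = Linked⇒AllPairs-on (λ {x} {y} {z} → ⪯ω-trans x y z) rows-nonempty ss-sorted

  map-rot-rows : map rot ss ↭ ss
  map-rot-rows = begin
      map rot ss                          ↭⟨ map⁺ rot ss↭ ⟩
      map rot (concatMap rotations us)    ≡⟨ map-concatMap rot rotations us ⟩
      concatMap (map rot ∘ rotations) us  ↭⟨ concatMap-↭ map-rot-rotations us ⟩
      concatMap rotations us              ↭⟨ ss↭ ⟨
      ss                                  ∎
    where open PermutationReasoning

  first-column-exists : ∃[ F ] Pointwise (λ s c → head s ≡ just c) ss F
  first-column-exists = Pointwise-just head (All.map head-defined rows-nonempty)
    where
    head-defined : ∀ {s} → 0 < length s → ∃[ c ] head s ≡ just c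
    head-defined {c ∷ _} _ = c , refl

  F : Word σ
  F = proj₁ first-column-exists

  first-column : Pointwise (λ s c → head s ≡ just c) ss F
  first-column = proj₂ first-column-exists

  first-column-sorted : Linked Fin._≤_ F
  first-column-sorted = heads-sorted ss-sorted first-column
    where
    heads-sorted : ∀ {ts cs} → Linked _⪯ω_ ts → Pointwise (λ s c → head s ≡ just c) ts cs → Linked Fin._≤_ cs
    heads-sorted []  []           = []
    heads-sorted [-] (_ ∷ [])     = [-]
    heads-sorted {s ∷ t ∷ _} (s⪯t ∷ lk) (es ∷ et ∷ rs) =
      ≮⇒≥ (λ d<c → s⪯t (0 , (λ _ ()) , _ , _ , trans (ω-at-0 t) et , trans (ω-at-0 s) es , d<c)) ∷
      heads-sorted lk (et ∷ rs)

  last-column′ : Pointwise (λ s c → head (rot s) ≡ just c) ss z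
  last-column′ = Pointwise.map (λ {s} e → trans (head-rot s) e) last-column

  open SortedPermutation (λ s → 0 < length s) (_≺ω?_ {σ}) (≺ω-irrefl _) (λ {x} {y} {z} → ⪯ω-trans x y z)

  starts? : (c : Fin σ) (s : Word σ) → Dec (head s ≡ just c)
  starts? c s = head s ≟ᴹ just c

  rows-starting : Fin σ → List (Word σ)
  rows-starting c = filter (starts? c) ss

  rotated-rows-ending : Fin σ → List (Word σ)
  rotated-rows-ending c = map rot (filter (starts? c ∘ rot) ss)

  rows-starting↭ : (c : Fin σ) → rows-starting c ↭ rotated-rows-ending c
  rows-starting↭ c =
    subst (rows-starting c ↭_) (filter-map rot (starts? c) ss) (filter-↭ (starts? c) (↭-sym map-rot-rows))

  rows-starting-sorted : (c : Fin σ) → Sorted (rows-starting c)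
  rows-starting-sorted c = AllPairsP.filter⁺ (starts? c) rows-sorted

  rotated-rows-ending-sorted : (c : Fin σ) → Sorted (rotated-rows-ending c)
  rotated-rows-ending-sorted c =
    map-rot-sorted (AllP.all-filter (starts? c ∘ rot) ss) (AllPairsP.filter⁺ (starts? c ∘ rot) rows-sorted)

  rows-starting-nonempty : (c : Fin σ) → All (λ s → 0 < length s) (rows-starting c)
  rows-starting-nonempty c = AllP.filter⁺ (starts? c) rows-nonempty

  rotated-rows-ending-nonempty : (c : Fin σ) → All (λ s → 0 < length s) (rotated-rows-ending c)
  rotated-rows-ending-nonempty c =
    AllP.map⁺ (All.map (λ {t} 0<t → subst (0 <_) (sym (length-rot t)) 0<t)
                       (AllP.filter⁺ (starts? c ∘ rot) rows-nonempty))

  count-first-column : (c : Fin σ) → count c F ≡ count c z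
  count-first-column c = begin
      count c F                                  ≡⟨ count-Pointwise head c first-column ⟨
      length (rows-starting c)                   ≡⟨ ↭-length (rows-starting↭ c) ⟩
      length (rotated-rows-ending c)             ≡⟨ length-map rot (filter (starts? c ∘ rot) ss) ⟩
      length (filter (starts? c ∘ rot) ss)       ≡⟨ count-Pointwise (head ∘ rot) c last-column′ ⟩
      count c z                                  ∎
    where open ≡-Reasoning

  -- The LF-mapping: the occurrence of the letter c in row r of the first column and the occurrence
  -- of c in row r′ of the last column with the same rank belong to the same rotation.
  LF-mapping : ∀ {r r′ s s′ c} → ss !? r ≡ just s → ss !? r′ ≡ just s′ → F !? r ≡ just c → z !? r′ ≡ just c →
               count c (take r F) ≡ count c (take r′ z) → s ≈ω rot s′
  LF-mapping {r} {r′} {s} {s′} {c} ss-r ss-r′ F-r z-r′ same-rank =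
    ⪯ω-antisym s (rot s′) (All-!? r rows-nonempty ss-r) 0<rot-s′
      (sorted-↭-≮ P₂ P₁ ok₂ sorted₂ sorted₁ (↭-sym l₁↭l₂) (sym |P₁|≡|P₂|))
      (sorted-↭-≮ P₁ P₂ ok₁ sorted₁ sorted₂ l₁↭l₂ |P₁|≡|P₂|)
    where
    P₁ = filter (starts? c) (take r ss)
    P₂ = map rot (filter (starts? c ∘ rot) (take r′ ss))
    l₁ = P₁ ++ s ∷ filter (starts? c) (drop (suc r) ss)
    l₂ = P₂ ++ rot s′ ∷ map rot (filter (starts? c ∘ rot) (drop (suc r′) ss))

    head-s : head s ≡ just c
    head-s with Pointwise-!? r first-column ss-r
    ... | d , F-r′ , head-s≡d = trans head-s≡d (cong just (just-injective (trans (sym F-r′) F-r)))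
    head-rot-s′ : head (rot s′) ≡ just c
    head-rot-s′ with Pointwise-!? r′ last-column′ ss-r′
    ... | d , z-r″ , head≡d = trans head≡d (cong just (just-injective (trans (sym z-r″) z-r′)))
    0<rot-s′ : 0 < length (rot s′)
    0<rot-s′ = subst (0 <_) (sym (length-rot s′)) (All-!? r′ rows-nonempty ss-r′)

    l₁≡ : rows-starting c ≡ l₁
    l₁≡ = filter-!? (starts? c) ss r ss-r head-s
    l₂≡ : rotated-rows-ending c ≡ l₂
    l₂≡ = trans (cong (map rot) (filter-!? (starts? c ∘ rot) ss r′ ss-r′ head-rot-s′))
                (map-++ rot (filter (starts? c ∘ rot) (take r′ ss)) _)
    l₁↭l₂ : l₁ ↭ l₂
    l₁↭l₂ = subst₂ _↭_ l₁≡ l₂≡ (rows-starting↭ c)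
    sorted₁ : Sorted l₁
    sorted₁ = subst Sorted l₁≡ (rows-starting-sorted c)
    sorted₂ : Sorted l₂
    sorted₂ = subst Sorted l₂≡ (rotated-rows-ending-sorted c)
    ok₁ : All (λ t → 0 < length t) l₁
    ok₁ = subst (All _) l₁≡ (rows-starting-nonempty c)
    ok₂ : All (λ t → 0 < length t) l₂
    ok₂ = subst (All _) l₂≡ (rotated-rows-ending-nonempty c)

    |P₁|≡|P₂| : length P₁ ≡ length P₂
    |P₁|≡|P₂| = begin
        length P₁                                    ≡⟨ count-Pointwise head c (Pointwise-take r first-column) ⟩
        count c (take r F)                           ≡⟨ same-rank ⟩
        count c (take r′ z)                          ≡⟨ count-Pointwise (head ∘ rot) c (Pointwise-take r′ last-column′) ⟨
        length (filter (starts? c ∘ rot) (take r′ ss)) ≡⟨ length-map rot (filter (starts? c ∘ rot) (take r′ ss)) ⟨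
        length P₂                                    ∎
      where open ≡-Reasoning

  minimal-row : ∀ {s t} → ss !? 0 ≡ just s → t ∈ ss → s ⪯ω t
  minimal-row {s} ss-0 t∈ss with ss≡ ← sym (take-!?-drop ss 0 ss-0) =
    go (subst (AllPairs _⪯ω_) ss≡ rows-sorted) (subst (_ ∈_) ss≡ t∈ss)
    where
    go : ∀ {t rest} → AllPairs _⪯ω_ (s ∷ rest) → t ∈ s ∷ rest → s ⪯ω t
    go _          (here refl) = ≺ω-irrefl s
    go (s⪯ ∷ _)   (there t∈)  = All.lookup s⪯ t∈

  first-row-is-factor : ∀ {s} → ss !? 0 ≡ just s → s ∈ us
  first-row-is-factor ss-0 with ∈-rotations us (∈-resp-↭ ss↭ (∈-!? ss 0 ss-0))
  ... | u , zero  , u∈us , _   , refl = u∈us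
  ... | u , suc t , u∈us , t<n , refl =
    contradiction (Lyndon⇒≺ω-rot^ u u-Lyndon (s≤s z≤n) t<n) (minimal-row ss-0 u∈ss)
    where
    u-Lyndon : Lyndon u
    u-Lyndon = All.lookup us-Lyndon u∈us
    u∈ss : u ∈ ss
    u∈ss = ∈-resp-↭ (↭-sym ss↭) (∈-rotations⁺ us u∈us (proj₁ u-Lyndon))

module Lemma2 {σ : ℕ} (xs : Word σ) (b a : Fin σ)
  (x-i≡a : at (xs ∷ʳ b) (lcp (xs ∷ʳ b) (sortedWord (xs ∷ʳ b))) ≡ just a) (a≢b : a ≢ b)
  (us ss : List (Word σ)) (us-Lyndon : All Lyndon us) (ss↭ : ss ↭ concatMap rotations us)
  (ss-sorted : Linked _⪯ω_ ss) (last-column : Pointwise (λ s c → last s ≡ just c) ss (rot (xs ∷ʳ b))) where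

  open BBWTMatrix us ss (rot (xs ∷ʳ b)) us-Lyndon ss↭ ss-sorted last-column

  x y : Word σ
  x = xs ∷ʳ b
  y = sortedWord x

  i : ℕ
  i = lcp x y

  count-F : ∀ c → count c F ≡ count c x
  count-F c = trans (count-first-column c) (count-rot c x)

  y≡F : y ≡ F
  y≡F = trans (sortedWord-cong x F (sym ∘ count-F)) (sortedWord-sorted σ F first-column-sorted)

  y-sorted : AllPairs Fin._≤_ y
  y-sorted = subst (AllPairs Fin._≤_) (sym y≡F) (Linked⇒AllPairs FinP.≤-trans first-column-sorted)

  same-counts : ∀ c → count c x ≡ count c y
  same-counts c = trans (sym (count-F c)) (cong (count c) (sym y≡F))

  |x|≡ : length x ≡ suc (length xs)
  |x|≡ = trans (length-++ xs) (+-comm (length xs) 1)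

  x-last : x !? length xs ≡ just b
  x-last = !?-middle xs [] b

  i′-spec : ∃[ i′ ] (i ≡ suc i′ × x !? i′ ≡ just a)
  i′-spec = at≡just x i x-i≡a

  i′ : ℕ
  i′ = proj₁ i′-spec

  i≡1+i′ : i ≡ suc i′
  i≡1+i′ = proj₁ (proj₂ i′-spec)

  x-i′ : x !? i′ ≡ just a
  x-i′ = proj₂ (proj₂ i′-spec)

  i′<i : i′ < i
  i′<i = subst (i′ <_) (sym i≡1+i′) ≤-refl

  i≤|xs| : i ≤ length xs
  i≤|xs| with m≤n⇒m<n∨m≡n (subst (i ≤_) |x|≡ (lcp-≤ x y))
  ... | inj₁ i<n = s≤s⁻¹ i<n
  ... | inj₂ i≡n = contradiction (just-injective (trans (sym x-i′) x-i′≡b)) a≢b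
    where
    x-i′≡b : x !? i′ ≡ just b
    x-i′≡b = subst (λ k → x !? k ≡ just b) (suc-injective (trans (sym i≡n) i≡1+i′)) x-last

  i<|x| : i < length x
  i<|x| = subst (i <_) (sym |x|≡) (s≤s i≤|xs|)

  |ss|≡|x| : length ss ≡ length x
  |ss|≡|x| = trans (Pointwise-length last-column) (length-rot x)

  |y|≡|x| : length y ≡ length x
  |y|≡|x| = trans (cong length y≡F) (trans (sym (Pointwise-length first-column)) |ss|≡|x|)

  x≈y-below-i : ∀ {j} → j < i → x !? j ≡ y !? j
  x≈y-below-i = lcp-agree x y

  take-x≡take-y : ∀ {k} → k ≤ i → take k x ≡ take k y
  take-x≡take-y {k} k≤i = take-cong-!? x y k (λ j j<k → x≈y-below-i (<-≤-trans j<k k≤i))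

  y-mismatch-x : Mismatch i y x
  y-mismatch-x with !?-defined y (subst (i <_) (sym |y|≡|x|) i<|x|) | !?-defined x i<|x|
  ... | p , y-i | q , x-i =
    (λ j j<i → sym (x≈y-below-i j<i)) , p , q , y-i , x-i ,
    FinP.≤∧≢⇒< (sorted-rearrangement-min x y i same-counts y-sorted (take-x≡take-y ≤-refl) ≤-refl y-i x-i)
               (λ p≡q → lcp-mismatch x y x-i y-i (sym p≡q))

  -- a = y[i′] is the least of the letters of x from position i′ on, one of which is b.
  no-b-below-i : ∀ {r} → r < i → y !? r ≢ just b
  no-b-below-i {r} r<i y-r≡b = a≢b (FinP.≤-antisym a≤b b≤a)
    where
    y-i′ : y !? i′ ≡ just a
    y-i′ = trans (sym (x≈y-below-i i′<i)) x-i′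
    a≤b : a Fin.≤ b
    a≤b = sorted-rearrangement-min x y i′ same-counts y-sorted (take-x≡take-y (<⇒≤ i′<i))
            (≤-trans (<⇒≤ i′<i) i≤|xs|) y-i′ x-last
    b≤a : b Fin.≤ a
    b≤a = sorted-!?-≤ y-sorted (s≤s⁻¹ (subst (r <_) i≡1+i′ r<i)) y-r≡b y-i′

  row : ∀ {r} → r < length x → ∃[ s ] ss !? r ≡ just s
  row r<n = !?-defined ss (subst (_ <_) (sym |ss|≡|x|) r<n)

  head-row≡y : ∀ {r s} → ss !? r ≡ just s → head s ≡ y !? r
  head-row≡y {r} ss-r with Pointwise-!? r first-column ss-r
  ... | c , F-r , head-s = trans head-s (trans (sym F-r) (cong (_!? r) (sym y≡F)))

  z≡b∷xs : rot x ≡ b ∷ xs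
  z≡b∷xs = rot-∷ʳ xs b

  LF-step : ∀ {r s s′} → suc r ≤ i → ss !? r ≡ just s → ss !? suc r ≡ just s′ → s ≈ω rot s′
  LF-step {r} r<i ss-r ss-r′ with !?-defined y (subst (r <_) (sym |y|≡|x|) (<-trans r<i i<|x|))
  ... | c , y-r = LF-mapping {r} {suc r} ss-r ss-r′ (trans (cong (_!? r) (sym y≡F)) y-r) z-r′ same-rank
    where
    r<|xs| : r < length xs
    r<|xs| = <-≤-trans r<i i≤|xs|
    z-r′ : rot x !? suc r ≡ just c
    z-r′ = begin
        rot x !? suc r   ≡⟨ cong (_!? suc r) z≡b∷xs ⟩
        xs !? r          ≡⟨ !?-++ˡ xs (b ∷ []) r<|xs| ⟨
        x !? r           ≡⟨ x≈y-below-i r<i ⟩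
        y !? r           ≡⟨ y-r ⟩
        just c           ∎
      where open ≡-Reasoning
    b≢c : b ≢ c
    b≢c refl = no-b-below-i r<i y-r
    same-rank : count c (take r F) ≡ count c (take (suc r) (rot x))
    same-rank = begin
        count c (take r F)              ≡⟨ cong (count c ∘ take r) y≡F ⟨
        count c (take r y)              ≡⟨ cong (count c) (take-x≡take-y (<⇒≤ r<i)) ⟨
        count c (take r x)              ≡⟨ cong (count c) (take-++ˡ xs (b ∷ []) (<⇒≤ r<|xs|)) ⟩
        count c (take r xs)             ≡⟨ count-∷-≢ (take r xs) b≢c ⟨
        count c (b ∷ take r xs)         ≡⟨ cong (count c ∘ take (suc r)) z≡b∷xs ⟨
        count c (take (suc r) (rot x))  ∎
      where open ≡-Reasoning

  -- Row r is row r + 1 rotated by one, so row r spells y from position r on.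
  row-≈-y : ∀ m r {s} → r + m ≡ i → ss !? r ≡ just s → ∀ j → j ≤ m → ω-at s j ≡ y !? (r + j)
  row-≈-y m       r {s} _   ss-r zero    _         =
    trans (ω-at-0 s) (trans (head-row≡y {r} ss-r) (cong (y !?_) (sym (+-identityʳ r))))
  row-≈-y (suc m) r {s} r+m≡i ss-r (suc j) (s≤s j≤m) = next-row (subst (r <_) r+m≡i (m<m+n r (s≤s z≤n)))
    where
    next-row : r < i → ω-at s (suc j) ≡ y !? (r + suc j)
    next-row r<i with row (≤-<-trans r<i i<|x|)
    ... | s′ , ss-r′ = begin
        ω-at s (suc j)         ≡⟨ LF-step {r} r<i ss-r ss-r′ (suc j) ⟩
        ω-at (rot s′) (suc j)  ≡⟨ ω-at-rot s′ j ⟩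
        ω-at s′ j              ≡⟨ row-≈-y m (suc r) (trans (sym (+-suc r m)) r+m≡i) ss-r′ j j≤m ⟩
        y !? (suc r + j)       ≡⟨ cong (y !?_) (+-suc r j) ⟨
        y !? (r + suc j)       ∎
      where open ≡-Reasoning

  first-row-≈-y : ∀ {s} → ss !? 0 ≡ just s → ∀ {j} → j ≤ i → ω-at s j ≡ y !? j
  first-row-≈-y ss-0 {j} j≤i = row-≈-y i 0 refl ss-0 j j≤i

  -- The first row ends with b, the first letter of z, and b does not occur in y before position i.
  i<|first-row| : ∀ {s} → ss !? 0 ≡ just s → i < length s
  i<|first-row| {s} ss-0 with i <? length s
  ... | yes i<|s| = i<|s|
  ... | no  i≮|s| = contradiction y-j≡b (no-b-below-i (<-≤-trans j<|s| (≮⇒≥ i≮|s|)))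
    where
    0<|s| : 0 < length s
    0<|s| = All-!? 0 rows-nonempty ss-0
    j = length s ∸ 1
    j<|s| : j < length s
    j<|s| = subst (j <_) (m+[n∸m]≡n 0<|s|) ≤-refl
    last-s : last s ≡ just b
    last-s with Pointwise-!? 0 last-column ss-0
    ... | c , z-0 , last-s≡c = trans last-s≡c (trans (sym z-0) (cong (_!? 0) z≡b∷xs))
    y-j≡b : y !? j ≡ just b
    y-j≡b = begin
        y !? j      ≡⟨ first-row-≈-y ss-0 (<⇒≤ (<-≤-trans j<|s| (≮⇒≥ i≮|s|))) ⟨
        ω-at s j    ≡⟨ ω-at-< s j<|s| ⟩
        s !? j      ≡⟨ !?-last s 0<|s| ⟩
        last s      ≡⟨ last-s ⟩
        just b      ∎
      where open ≡-Reasoning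

  rotation-below-x : ∃[ k ] (rot^ k (concat us) ≺ x)
  rotation-below-x with row (≤-<-trans z≤n i<|x|)
  ... | s , ss-0 with ∈-∃++ (first-row-is-factor ss-0)
  ...   | U₁ , U₂ , us≡ = length (s ++ concat U₂) , subst (_≺ x) (sym (rot^-concat us≡)) s++R≺x
    where
    R = concat U₂ ++ concat U₁
    s++R≈y : ∀ {j} → j ≤ i → (s ++ R) !? j ≡ y !? j
    s++R≈y {j} j≤i = begin
        (s ++ R) !? j   ≡⟨ !?-++ˡ s R j<|s| ⟩
        s !? j          ≡⟨ ω-at-< s j<|s| ⟨
        ω-at s j        ≡⟨ first-row-≈-y ss-0 j≤i ⟩
        y !? j          ∎
      where
      open ≡-Reasoning
      j<|s| = ≤-<-trans j≤i (i<|first-row| ss-0)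
    s++R≺x : (s ++ R) ≺ x
    s++R≺x = mismatch⇒≺ (s ++ R) x i (Mismatch-respˡ s++R≈y y-mismatch-x)

lemma2 : (σ : ℕ) (x : Word σ) → 1 ≤ length x → MinRotation x →
    (Σ (Fin σ) λ a → Σ (Fin σ) λ b →
       at x (lcp x (sortedWord x)) ≡ just a × at x (length x) ≡ just b × a ≢ b) →
    (w : Word σ) → IsBBWT w (rot x) →
    ∃[ k ] (rot^ k w ≺ x)
lemma2 σ x 1≤|x| _ (a , b , x-i≡a , x-n≡b , a≢b) w
       (us , ss , (us-Lyndon , _ , concat-us≡w) , ss↭ , ss-sorted , last-column) with reverseView x
... | []          = contradiction 1≤|x| λ ()
... | xs ∶ _ ∶ʳ c with refl ← just-injective (trans (sym (at-length-∷ʳ xs c)) x-n≡b) =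
  subst (λ v → ∃[ k ] (rot^ k v ≺ (xs ∷ʳ b))) concat-us≡w
        (Lemma2.rotation-below-x xs b a x-i≡a a≢b us ss us-Lyndon ss↭ ss-sorted last-column)
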